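{- Let $G$ be a graph and let $\ell$ be a weakly subadditive real function on subsets of $V(G)$. If $G$ is $\ell$-rigid, then for any two disjoint vertex sets $A$ and $B$, $$d_{G-B}(A)\ge\ell(A\cup B)-\sum_{v\in B}\ell(v)+\big(\ell(V(G)\setminus A)-\ell(V(G))\big).$$
   Context: Graphs are finite, loopless, multiple edges allowed. $d_{G-B}(A)$ is the number of edges of $G-B$ with exactly one end in $A$; $e_H(X)$ is the number of edges of $H$ with both ends in $X$. Set functions are zero on $\emptyset$, $\ell(v)=\ell(\{v\})$; weakly subadditive means $\sum_{v\in A}\ell(v)\ge\ell(A)$ for all $A$. $G$ is $\ell$-rigid if it has a spanning subgraph $F$ with $e_F(X)\le\sum_{v\in X}\ell(v)-\ell(X)$ for all $X\subseteq V(G)$ (i.e. $F$ is $\ell$-sparse) and $|E(F)|=\sum_{v\in V(G)}\ell(v)-\ell(V(G))$. -}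

module Defs where

open import Level using (Level; _⊔_) renaming (suc to lsuc)
open import Data.Nat using (ℕ; zero; suc)
open import Data.Bool using (Bool; true; false; _∧_; _∨_; not; if_then_else_)
open import Data.Product using (_×_; _,_; Σ-syntax; proj₁; proj₂)
open import Data.Fin using (Fin)
open import Data.Fin.Subset using (Subset; ⊤; ⊥; ⁅_⁆; _∩_; _∪_; ∁; Empty)
open import Data.Vec using (lookup)
open import Data.List using (List; length; filter)
open import Data.List.Relation.Unary.All using (All)
open import Data.List.Relation.Binary.Sublist.Propositional using (_⊆_)
open import Data.Bool.Properties using (T?)
open import Relation.Binary.Core using (Rel)
open import Relation.Binary.Structures using (IsTotalOrder)
open import Relation.Binary.PropositionalEquality using (_≢_)
open import Relation.Nullary.Decidable using (Dec)
open import Algebra.Bundles using (CommutativeRing)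
open import Data.Vec.Functional using () renaming (foldr to vfoldr)

-- Totally ordered commutative rings (ℝ is an instance).  The paper's
-- set functions are real-valued; since agda-stdlib has no reals we work
-- over an arbitrary totally ordered commutative ring.

record OrderedCommutativeRing (c ℓ₁ ℓ₂ : Level) : Set (lsuc (c ⊔ ℓ₁ ⊔ ℓ₂)) where
  field
    commutativeRing : CommutativeRing c ℓ₁
  open CommutativeRing commutativeRing public
  infix 4 _≤_
  field
    _≤_           : Rel Carrier ℓ₂
    isTotalOrder  : IsTotalOrder _≈_ _≤_
    +-monoˡ-≤     : ∀ z {x y} → x ≤ y → (x + z) ≤ (y + z)
    *-nonneg      : ∀ {x y} → 0# ≤ x → 0# ≤ y → 0# ≤ (x * y)

-- Graphs: vertex set Fin n, edges a list of ordered pairs (multiple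
-- edges allowed as repeated list entries), loopless.

Edge : ℕ → Set
Edge n = Fin n × Fin n

record Graph (n : ℕ) : Set where
  field
    edges    : List (Edge n)
    loopless : All (λ e → proj₁ e ≢ proj₂ e) edges

_∈ᵇ_ : {n : ℕ} → Fin n → Subset n → Bool
x ∈ᵇ p = lookup p x

bothIn : {n : ℕ} → Subset n → Edge n → Bool
bothIn X (u , v) = (u ∈ᵇ X) ∧ (v ∈ᵇ X)

exactlyOneIn : {n : ℕ} → Subset n → Edge n → Bool
exactlyOneIn A (u , v) = (u ∈ᵇ A) ∧ not (v ∈ᵇ A) ∨ not (u ∈ᵇ A) ∧ (v ∈ᵇ A)

avoids : {n : ℕ} → Subset n → Edge n → Bool
avoids B (u , v) = not (u ∈ᵇ B) ∧ not (v ∈ᵇ B)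

countᵇ : {n : ℕ} → (Edge n → Bool) → List (Edge n) → ℕ
countᵇ P es = length (filter (λ e → T? (P e)) es)

eIn : {n : ℕ} → List (Edge n) → Subset n → ℕ
eIn es X = countᵇ (bothIn X) es

dMinus : {n : ℕ} → Graph n → Subset n → Subset n → ℕ
dMinus G B A = countᵇ (λ e → avoids B e ∧ exactlyOneIn A e) (Graph.edges G)

module SetFunctions {c ℓ₁ ℓ₂} (R : OrderedCommutativeRing c ℓ₁ ℓ₂) where
  open OrderedCommutativeRing R

  fromℕ : ℕ → Carrier
  fromℕ zero    = 0#
  fromℕ (suc k) = 1# + fromℕ k

  sumOver : {n : ℕ} → (Subset n → Carrier) → Subset n → Carrier
  sumOver {n} ℓ X = vfoldr _+_ 0# (λ v → if v ∈ᵇ X then ℓ ⁅ v ⁆ else 0#)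

  IsSetFunction : {n : ℕ} → (Subset n → Carrier) → Set ℓ₁
  IsSetFunction ℓ = ℓ ⊥ ≈ 0#

  WeaklySubadditive : {n : ℕ} → (Subset n → Carrier) → Set ℓ₂
  WeaklySubadditive {n} ℓ = (A : Subset n) → ℓ A ≤ sumOver ℓ A

  Sparse : {n : ℕ} → (Subset n → Carrier) → List (Edge n) → Set ℓ₂
  Sparse {n} ℓ F = (X : Subset n) → fromℕ (eIn F X) ≤ (sumOver ℓ X - ℓ X)

  Rigid : {n : ℕ} → (Subset n → Carrier) → Graph n → Set (ℓ₁ ⊔ ℓ₂)
  Rigid {n} ℓ G = Σ[ F ∈ List (Edge n) ]
    (F ⊆ Graph.edges G) × Sparse ℓ F × (fromℕ (length F) ≈ (sumOver ℓ ⊤ - ℓ ⊤))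

-- Let F ⊆ E(G) be ℓ-sparse with |F| = Σ_V ℓ − ℓ(V).  As A and B are disjoint, every
-- edge of F lies inside V ∖ A, inside A ∪ B, or is an edge of G − B with exactly one end
-- in A.  Sparsity bounds the first two classes by Σ_{V∖A} ℓ − ℓ(V ∖ A) and
-- Σ_{A∪B} ℓ − ℓ(A ∪ B), and Σ_{V∖A} ℓ + Σ_{A∪B} ℓ = Σ_V ℓ + Σ_B ℓ, so comparing with |F|
-- leaves d_{G−B}(A) bounded below as claimed.
module Submission where

open import Defs
open import Level using (Level)
open import Data.Nat as ℕ using (ℕ; zero; suc; z≤n; s≤s)
open import Data.Nat.Properties as ℕ using (+-suc; n≤1+n; m+[n∸m]≡n)
open import Data.Bool using (Bool; true; false; _∧_; _∨_; not; if_then_else_; T)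
open import Data.Bool.Properties using (T?)
open import Data.Empty using (⊥-elim)
open import Data.Product using (_,_)
open import Data.Sum using (inj₁; inj₂)
open import Data.Fin using (Fin)
open import Data.Fin.Subset using (Subset; ⊤; _∩_; _∪_; ∁; Empty; ⁅_⁆)
open import Data.Vec using (lookup)
open import Data.Vec.Properties using (lookup-map; lookup-zipWith; lookup-replicate; lookup⇒[]=)
open import Data.List using (List; []; _∷_; length)
open import Data.List.Properties using (filter-all)
open import Data.List.Relation.Unary.All using (universal)
open import Data.List.Relation.Binary.Sublist.Propositional using (_⊆_)
open import Data.List.Relation.Binary.Sublist.Propositional.Properties using (filter⁺; length-mono-≤)
open import Relation.Binary.PropositionalEquality as ≡ using (_≡_)
open import Relation.Binary.Bundles using (Poset)
open import Relation.Binary.Structures using (IsTotalOrder)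

module _ {n : ℕ} where

  countᵇ-mono : (Q : Edge n → Bool) {F G : List (Edge n)} → F ⊆ G → countᵇ Q F ℕ.≤ countᵇ Q G
  countᵇ-mono Q F⊆G = length-mono-≤ (filter⁺ (λ e → T? (Q e)) (λ e → T? (Q e)) (λ { ≡.refl q → q }) F⊆G)

  countᵇ-∨ : (P Q : Edge n → Bool) (es : List (Edge n)) →
    countᵇ (λ e → P e ∨ Q e) es ℕ.≤ countᵇ P es ℕ.+ countᵇ Q es
  countᵇ-∨ P Q [] = z≤n
  countᵇ-∨ P Q (e ∷ es) with P e | Q e
  ... | true  | true  = s≤s (ℕ.≤-trans (countᵇ-∨ P Q es) (ℕ.+-monoʳ-≤ (countᵇ P es) (n≤1+n _)))
  ... | true  | false = s≤s (countᵇ-∨ P Q es)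
  ... | false | true  = ℕ.≤-trans (s≤s (countᵇ-∨ P Q es)) (ℕ.≤-reflexive (≡.sym (+-suc _ _)))
  ... | false | false = countᵇ-∨ P Q es

  countᵇ-universal : (Q : Edge n → Bool) → (∀ e → T (Q e)) → (es : List (Edge n)) →
    countᵇ Q es ≡ length es
  countᵇ-universal Q q es = ≡.cong length (filter-all (λ e → T? (Q e)) (universal q es))

  ∩-empty⇒∧-false : (A B : Subset n) → Empty (A ∩ B) → ∀ v → lookup A v ∧ lookup B v ≡ false
  ∩-empty⇒∧-false A B A∩B≡∅ v with lookup A v ∧ lookup B v in eq
  ... | false = ≡.refl
  ... | true  = ⊥-elim (A∩B≡∅ (v , lookup⇒[]= v (A ∩ B) (≡.trans (lookup-zipWith _∧_ v A B) eq)))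

edge-coverᵇ : ∀ a a' b b' → a ∧ b ≡ false → a' ∧ b' ≡ false →
  T ((not a ∧ not a') ∨ ((a ∨ b) ∧ (a' ∨ b')) ∨ ((not b ∧ not b') ∧ (a ∧ not a' ∨ not a ∧ a')))
edge-coverᵇ false false b     b'    _    _    = _
edge-coverᵇ true  true  false false ≡.refl ≡.refl = _
edge-coverᵇ true  false false true  ≡.refl _    = _
edge-coverᵇ true  false false false ≡.refl _    = _
edge-coverᵇ false true  true  false _    ≡.refl = _
edge-coverᵇ false true  false false _    ≡.refl = _

module _ {n : ℕ} (A B : Subset n) (A∩B≡∅ : Empty (A ∩ B)) where

  edge-cover : ∀ e → T (bothIn (∁ A) e ∨ bothIn (A ∪ B) e ∨ (avoids B e ∧ exactlyOneIn A e))
  edge-cover (u , v)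
    rewrite lookup-map u not A | lookup-map v not A
          | lookup-zipWith _∨_ u A B | lookup-zipWith _∨_ v A B
    = edge-coverᵇ (lookup A u) (lookup A v) (lookup B u) (lookup B v)
        (∩-empty⇒∧-false A B A∩B≡∅ u) (∩-empty⇒∧-false A B A∩B≡∅ v)

  length≤eIn∁+eIn∪+dMinus : (G : Graph n) {F : List (Edge n)} → F ⊆ Graph.edges G →
    length F ℕ.≤ eIn F (∁ A) ℕ.+ (eIn F (A ∪ B) ℕ.+ dMinus G B A)
  length≤eIn∁+eIn∪+dMinus G {F} F⊆E = begin
    length F
      ≡⟨ countᵇ-universal _ edge-cover F ⟨
    countᵇ (λ e → bothIn (∁ A) e ∨ bothIn (A ∪ B) e ∨ crossing e) F
      ≤⟨ countᵇ-∨ _ _ F ⟩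
    eIn F (∁ A) ℕ.+ countᵇ (λ e → bothIn (A ∪ B) e ∨ crossing e) F
      ≤⟨ ℕ.+-monoʳ-≤ (eIn F (∁ A)) (countᵇ-∨ _ _ F) ⟩
    eIn F (∁ A) ℕ.+ (eIn F (A ∪ B) ℕ.+ countᵇ crossing F)
      ≤⟨ ℕ.+-monoʳ-≤ (eIn F (∁ A)) (ℕ.+-monoʳ-≤ (eIn F (A ∪ B)) (countᵇ-mono crossing F⊆E)) ⟩
    eIn F (∁ A) ℕ.+ (eIn F (A ∪ B) ℕ.+ dMinus G B A)
      ∎
    where
    open ℕ.≤-Reasoning
    crossing : Edge n → Bool
    crossing e = avoids B e ∧ exactlyOneIn A e

module OrderedRingProperties {c ℓ₁ ℓ₂ : Level} (R : OrderedCommutativeRing c ℓ₁ ℓ₂) where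
  open OrderedCommutativeRing R
  open SetFunctions R
  open IsTotalOrder isTotalOrder using (total; ≤-respˡ-≈; ≤-respʳ-≈)
    renaming (refl to ≤-refl; trans to ≤-trans)
  open import Algebra.Properties.Ring ring using (\\-leftDividesʳ; //-rightDividesʳ; -1*x≈-x; -‿involutive)
  open import Algebra.Properties.CommutativeMonoid.Sum +-commutativeMonoid using (sum; ∑-distrib-+; sum-cong-≋)
  open import Algebra.Solver.CommutativeMonoid +-commutativeMonoid using (solve; _⊕_; _⊜_)

  poset : Poset c ℓ₁ ℓ₂
  poset = record { isPartialOrder = IsTotalOrder.isPartialOrder isTotalOrder }

  +-monoʳ-≤ : ∀ z {x y} → x ≤ y → z + x ≤ z + y
  +-monoʳ-≤ z {x} {y} x≤y = ≤-respʳ-≈ (+-comm y z) (≤-respˡ-≈ (+-comm x z) (+-monoˡ-≤ z x≤y))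

  +-mono-≤ : ∀ {x x' y y'} → x ≤ x' → y ≤ y' → x + y ≤ x' + y'
  +-mono-≤ {x' = x'} {y} x≤x' y≤y' = ≤-trans (+-monoˡ-≤ y x≤x') (+-monoʳ-≤ x' y≤y')

  +-cancelˡ-≤ : ∀ z {x y} → z + x ≤ z + y → x ≤ y
  +-cancelˡ-≤ z {x} {y} z+x≤z+y =
    ≤-respʳ-≈ (\\-leftDividesʳ z y) (≤-respˡ-≈ (\\-leftDividesʳ z x) (+-monoʳ-≤ (- z) z+x≤z+y))

  0≤1 : 0# ≤ 1#
  0≤1 with total 0# 1#
  ... | inj₁ 0≤1 = 0≤1
  ... | inj₂ 1≤0 = ≤-respʳ-≈ -1*-1≈1 (*-nonneg 0≤-1 0≤-1)
    where
    0≤-1 : 0# ≤ - 1#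
    0≤-1 = ≤-respʳ-≈ (+-identityˡ (- 1#)) (≤-respˡ-≈ (-‿inverseʳ 1#) (+-monoˡ-≤ (- 1#) 1≤0))
    -1*-1≈1 : - 1# * - 1# ≈ 1#
    -1*-1≈1 = trans (-1*x≈-x (- 1#)) (-‿involutive 1#)

  fromℕ-nonneg : ∀ k → 0# ≤ fromℕ k
  fromℕ-nonneg zero    = ≤-refl
  fromℕ-nonneg (suc k) = ≤-respˡ-≈ (+-identityʳ 0#) (+-mono-≤ 0≤1 (fromℕ-nonneg k))

  fromℕ-+ : ∀ m k → fromℕ (m ℕ.+ k) ≈ fromℕ m + fromℕ k
  fromℕ-+ zero    k = sym (+-identityˡ (fromℕ k))
  fromℕ-+ (suc m) k = trans (+-congˡ (fromℕ-+ m k)) (sym (+-assoc 1# (fromℕ m) (fromℕ k)))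

  fromℕ-mono : ∀ {m k} → m ℕ.≤ k → fromℕ m ≤ fromℕ k
  fromℕ-mono {m} {k} m≤k = begin
    fromℕ m                   ≈⟨ +-identityʳ (fromℕ m) ⟨
    fromℕ m + 0#              ≤⟨ +-monoʳ-≤ (fromℕ m) (fromℕ-nonneg (k ℕ.∸ m)) ⟩
    fromℕ m + fromℕ (k ℕ.∸ m) ≈⟨ fromℕ-+ m (k ℕ.∸ m) ⟨
    fromℕ (m ℕ.+ (k ℕ.∸ m))   ≡⟨ ≡.cong fromℕ (m+[n∸m]≡n m≤k) ⟩
    fromℕ k                   ∎
    where open import Relation.Binary.Reasoning.PartialOrder poset

  indicator-∁+∪ : ∀ x a b → a ∧ b ≡ false →
    (if not a then x else 0#) + (if a ∨ b then x else 0#) ≈ x + (if b then x else 0#)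
  indicator-∁+∪ x true  false _ = +-comm 0# x
  indicator-∁+∪ x false b     _ = refl

  sumOver-∁+∪ : ∀ {n} (ℓ : Subset n → Carrier) (A B : Subset n) →
    (∀ v → lookup A v ∧ lookup B v ≡ false) →
    sumOver ℓ (∁ A) + sumOver ℓ (A ∪ B) ≈ sumOver ℓ ⊤ + sumOver ℓ B
  sumOver-∁+∪ {n} ℓ A B disjoint = begin
    sum (term (∁ A)) + sum (term (A ∪ B))     ≈⟨ ∑-distrib-+ (term (∁ A)) (term (A ∪ B)) ⟨
    sum (λ v → term (∁ A) v + term (A ∪ B) v) ≈⟨ sum-cong-≋ pointwise ⟩
    sum (λ v → term ⊤ v + term B v)            ≈⟨ ∑-distrib-+ (term ⊤) (term B) ⟩
    sum (term ⊤) + sum (term B)               ∎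
    where
    open import Relation.Binary.Reasoning.Setoid setoid
    term : Subset n → Fin n → Carrier
    term X v = if v ∈ᵇ X then ℓ ⁅ v ⁆ else 0#
    pointwise : ∀ v → term (∁ A) v + term (A ∪ B) v ≈ term ⊤ v + term B v
    pointwise v rewrite lookup-map v not A | lookup-zipWith _∨_ v A B | lookup-replicate v true
      = indicator-∁+∪ (ℓ ⁅ v ⁆) (lookup A v) (lookup B v) (disjoint v)

  -- The commutative-monoid solver treats each negated term as an atom; the cancellations
  -- x + y - y ≈ x are made explicitly.
  deficiency-balance : ∀ {T L C c D a S} → C + D ≈ T + S →
    ((C - c) + (D - a)) + ((a - S) + (c - L)) ≈ T - L
  deficiency-balance {T} {L} {C} {c} {D} {a} {S} C+D≈T+S = begin
    ((C - c) + (D - a)) + ((a - S) + (c - L))  ≈⟨ regroup C (- c) D (- a) a (- S) c (- L) ⟩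
    (C + D) + (- S - L) + c - c + a - a        ≈⟨ //-rightDividesʳ a _ ⟩
    (C + D) + (- S - L) + c - c                ≈⟨ //-rightDividesʳ c _ ⟩
    (C + D) + (- S - L)                        ≈⟨ +-congʳ C+D≈T+S ⟩
    (T + S) + (- S - L)                        ≈⟨ regroup′ T S (- S) (- L) ⟩
    T - L + S - S                              ≈⟨ //-rightDividesʳ S _ ⟩
    T - L                                      ∎
    where
    open import Relation.Binary.Reasoning.Setoid setoid
    regroup : ∀ C nc D na a nS c nL →
      ((C + nc) + (D + na)) + ((a + nS) + (c + nL)) ≈ (C + D) + (nS + nL) + c + nc + a + na
    regroup = solve 8 (λ C nc D na a nS c nL →
      ((C ⊕ nc) ⊕ (D ⊕ na)) ⊕ ((a ⊕ nS) ⊕ (c ⊕ nL)) ⊜ (((((C ⊕ D) ⊕ (nS ⊕ nL)) ⊕ c) ⊕ nc) ⊕ a) ⊕ na) refl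
    regroup′ : ∀ T S nS nL → (T + S) + (nS + nL) ≈ T + nL + S + nS
    regroup′ = solve 4 (λ T S nS nL → (T ⊕ S) ⊕ (nS ⊕ nL) ⊜ ((T ⊕ nL) ⊕ S) ⊕ nS) refl

proposition3p1 : {c ℓ₁ ℓ₂ : Level} (R : OrderedCommutativeRing c ℓ₁ ℓ₂) →
    let open OrderedCommutativeRing R in let open SetFunctions R in
    {n : ℕ} (G : Graph n) (ℓ : Subset n → Carrier) →
    IsSetFunction ℓ → WeaklySubadditive ℓ → Rigid ℓ G →
    (A B : Subset n) → Empty (A ∩ B) →
    (((ℓ (A ∪ B) - sumOver ℓ B) + (ℓ (∁ A) - ℓ ⊤)) ≤ fromℕ (dMinus G B A))
proposition3p1 R G ℓ _ _ (F , F⊆E , F-sparse , |F|≈) A B A∩B≡∅ = +-cancelˡ-≤ K (begin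
  K + ((ℓ (A ∪ B) - sumOver ℓ B) + (ℓ (∁ A) - ℓ ⊤))
    ≈⟨ deficiency-balance (sumOver-∁+∪ ℓ A B (∩-empty⇒∧-false A B A∩B≡∅)) ⟩
  sumOver ℓ ⊤ - ℓ ⊤
    ≈⟨ |F|≈ ⟨
  fromℕ (length F)
    ≤⟨ fromℕ-mono (length≤eIn∁+eIn∪+dMinus A B A∩B≡∅ G F⊆E) ⟩
  fromℕ (eIn F (∁ A) ℕ.+ (eIn F (A ∪ B) ℕ.+ d))
    ≈⟨ trans (fromℕ-+ (eIn F (∁ A)) _) (+-congˡ (fromℕ-+ (eIn F (A ∪ B)) d)) ⟩
  fromℕ (eIn F (∁ A)) + (fromℕ (eIn F (A ∪ B)) + fromℕ d)
    ≤⟨ +-mono-≤ (F-sparse (∁ A)) (+-monoˡ-≤ (fromℕ d) (F-sparse (A ∪ B))) ⟩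
  (sumOver ℓ (∁ A) - ℓ (∁ A)) + ((sumOver ℓ (A ∪ B) - ℓ (A ∪ B)) + fromℕ d)
    ≈⟨ +-assoc _ _ _ ⟨
  K + fromℕ d ∎)
  where
  open OrderedCommutativeRing R
  open SetFunctions R
  open OrderedRingProperties R
  open import Relation.Binary.Reasoning.PartialOrder poset
  d : ℕ
  d = dMinus G B A
  K : Carrier
  K = (sumOver ℓ (∁ A) - ℓ (∁ A)) + (sumOver ℓ (A ∪ B) - ℓ (A ∪ B))
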